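{- Let $A$ and $B$ be distinct atomic terms. Neither of the formulas $A\rightsquigarrow \lozenge B \Rightarrow B\rightsquigarrow\lozenge A$ and $A\rightsquigarrow \ominus B \Rightarrow B\rightsquigarrow\ominus A$ is valid (i.e. satisfied in every extensional model).
   Context: Terms over a set $T$ of atomic terms: atomic terms, and $A^c$, $\square A$, $\sqcup A$ for terms $A$; $\lozenge A := (\square(A^c))^c$, $\ominus A := (\sqcup A)^c$. An extensional model is $M=(I,V)$ with $I$ a nonempty set and $V$ a nonempty set of maps $v:T\to\mathcal P(I)$. For $v\in V$: $E_v(t)=v(t)$; $E_v(A^c)=I\setminus E_v(A)$; $E_v(\square A)=\bigcap_{w\in V}E_w(A)$; $E_v(\sqcup A)=\{a\in I: (\forall w\in V.\ a\in E_w(A)) \text{ or } (\forall w\in V.\ a\notin E_w(A))\}$. $M\Vdash A\rightsquigarrow B$ iff $E_v(A)\cap E_v(B)\neq\emptyset$ for all $v\in V$; $M\Vdash\phi\Rightarrow\psi$ iff $M\not\Vdash\phi$ or $M\Vdash\psi$. -}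

module Defs where

open import Data.Product using (Σ; ∃; _×_; _,_)
open import Data.Sum using (_⊎_)
open import Relation.Nullary using (¬_)

data Term (T : Set) : Set where
  atom : T → Term T
  _ᶜ   : Term T → Term T
  □_   : Term T → Term T
  ⊔_   : Term T → Term T

◇_ : {T : Set} → Term T → Term T
◇ A = (□ (A ᶜ)) ᶜ

⊖_ : {T : Set} → Term T → Term T
⊖ A = (⊔ A) ᶜ

data Formula (T : Set) : Set where
  _⇝_ : Term T → Term T → Formula T
  _⇒_ : Formula T → Formula T → Formula T

-- Extensional model M = (I, V): I a nonempty set, V a nonempty set of maps
-- T → 𝒫(I).  V is presented as a nonempty index type W together with
-- val : W → T → 𝒫(I); subsets of I are predicates I → Set.
record Model (T : Set) : Set₁ where
  field
    I     : Set
    I-ne  : I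
    W     : Set
    W-ne  : W
    val   : W → T → I → Set

module _ {T : Set} (M : Model T) where
  open Model M

  E : W → Term T → I → Set
  E v (atom t) a = val v t a
  E v (A ᶜ)    a = ¬ E v A a
  E v (□ A)    a = (w : W) → E w A a
  E v (⊔ A)    a = ((w : W) → E w A a) ⊎ ((w : W) → ¬ E w A a)

  Sat : Formula T → Set
  Sat (A ⇝ B) = (v : W) → ∃ λ a → E v A a × E v B a
  Sat (φ ⇒ ψ) = ¬ Sat φ ⊎ Sat ψ

Valid : {T : Set} → Formula T → Set₁
Valid {T} φ = (M : Model T) → Sat M φ

-- Two-valuation countermodels.  For ◇, on I = {false, true}: A is always {false} while B
-- is {true} in one valuation and {false} in the other, so ◇B is all of I (meeting A) but
-- ◇A = {false} misses B in the first valuation.  For ⊖, on a single point: A is always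
-- true, so ⊖A is empty, while B varies between the valuations, so ⊖B is the point and
-- meets A.
module Submission where

open import Defs
open import Data.Product using (_×_; _,_)
open import Data.Sum using (_⊎_; inj₁; inj₂)
open import Data.Bool using (Bool; true; false; not)
open import Data.Unit using (⊤; tt)
open import Data.Empty using (⊥-elim)
open import Relation.Nullary using (¬_)
open import Relation.Binary.PropositionalEquality using (_≢_; _≡_; refl; sym)

countermodel⇒¬valid : {T : Set} (φ ψ : Formula T) (M : Model T) →
  Sat M φ → ¬ Sat M ψ → ¬ Valid (φ ⇒ ψ)
countermodel⇒¬valid _ _ M sat-φ ¬sat-ψ valid with valid M
... | inj₁ ¬sat-φ = ¬sat-φ sat-φ
... | inj₂ sat-ψ  = ¬sat-ψ sat-ψ

-- Interpreting two distinct atoms A and B by given families; this needs no decidable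
-- equality on T.
module TwoAtoms {T : Set} (A B : T) (A≢B : A ≢ B) {I W : Set} (α β : W → I → Set) where

  val : W → T → I → Set
  val v t a = (t ≡ A × α v a) ⊎ (t ≡ B × β v a)

  val-A : ∀ {v a} → val v A a → α v a
  val-A (inj₁ (_ , αva))  = αva
  val-A (inj₂ (A≡B , _)) = ⊥-elim (A≢B A≡B)

  val-B : ∀ {v a} → val v B a → β v a
  val-B (inj₁ (B≡A , _)) = ⊥-elim (A≢B (sym B≡A))
  val-B (inj₂ (_ , βva))  = βva

module _ {T : Set} (A B : T) (A≢B : A ≢ B) where

  open TwoAtoms A B A≢B {Bool} {Bool} (λ _ a → a ≡ false) (λ v a → a ≡ not v)

  ◇-countermodel : Model T
  ◇-countermodel = record { I = Bool ; I-ne = false ; W = Bool ; W-ne = false ; val = val }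

  A⇝◇B : Sat ◇-countermodel (atom A ⇝ (◇ atom B))
  A⇝◇B v = false , inj₁ (refl , refl) , λ never-B → never-B true (inj₂ (refl , refl))

  ¬B⇝◇A : ¬ Sat ◇-countermodel (atom B ⇝ (◇ atom A))
  ¬B⇝◇A sat with sat false
  ... | a , B-at-a , ◇A-at-a with val-B B-at-a
  ... | refl = ◇A-at-a λ w A-at-true → true≢false (val-A A-at-true)
    where
    true≢false : true ≢ false
    true≢false ()

  ◇-symmetry-invalid : ¬ Valid ((atom A ⇝ (◇ atom B)) ⇒ (atom B ⇝ (◇ atom A)))
  ◇-symmetry-invalid = countermodel⇒¬valid (atom A ⇝ (◇ atom B)) (atom B ⇝ (◇ atom A))
    ◇-countermodel A⇝◇B ¬B⇝◇A

module _ {T : Set} (A B : T) (A≢B : A ≢ B) where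

  open TwoAtoms A B A≢B {⊤} {Bool} (λ _ _ → ⊤) (λ v _ → v ≡ true)

  ⊖-countermodel : Model T
  ⊖-countermodel = record { I = ⊤ ; I-ne = tt ; W = Bool ; W-ne = false ; val = val }

  A⇝⊖B : Sat ⊖-countermodel (atom A ⇝ (⊖ atom B))
  A⇝⊖B v = tt , inj₁ (refl , tt) , λ
    { (inj₁ always-B) → false≢true (val-B (always-B false))
    ; (inj₂ never-B)  → never-B true (inj₂ (refl , refl)) }
    where
    false≢true : false ≢ true
    false≢true ()

  ¬B⇝⊖A : ¬ Sat ⊖-countermodel (atom B ⇝ (⊖ atom A))
  ¬B⇝⊖A sat with sat false
  ... | tt , _ , ⊖A-at-tt = ⊖A-at-tt (inj₁ λ w → inj₁ (refl , tt))

  ⊖-symmetry-invalid : ¬ Valid ((atom A ⇝ (⊖ atom B)) ⇒ (atom B ⇝ (⊖ atom A)))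
  ⊖-symmetry-invalid = countermodel⇒¬valid (atom A ⇝ (⊖ atom B)) (atom B ⇝ (⊖ atom A))
    ⊖-countermodel A⇝⊖B ¬B⇝⊖A

lemma2p10 : {T : Set} (A B : T) → A ≢ B →
    ¬ Valid ((atom A ⇝ (◇ atom B)) ⇒ (atom B ⇝ (◇ atom A)))
    × ¬ Valid ((atom A ⇝ (⊖ atom B)) ⇒ (atom B ⇝ (⊖ atom A)))
lemma2p10 A B A≢B = ◇-symmetry-invalid A B A≢B , ⊖-symmetry-invalid A B A≢B
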